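{- Let $p,q$ be primes with $2<p<q$ and $\kappa+\lambda<p$. Then $g_1$ is representable if and only if the pair $(p,q)$ is of Type I.
   Context: Let $p,q$ be primes with $2<p<q$, and put $p'=(p-1)/2$, $q'=(q-1)/2$. Set $d_0=pq$, $d_1=p'q$, $d_2=pq'$, $d_3=(pq-1)/2$, and for integers $x,y,z,w$ put $f(x,y,z,w)=xd_0+yd_1+zd_2+wd_3$. An integer is representable if it equals $f(x,y,z,w)$ for some nonnegative integers $x,y,z,w$. Define integers $\kappa,\lambda,\kappa',\lambda'$ by $q=\kappa p+\lambda$ with $1\le\lambda\le p-1$ and $q'=\kappa'p'+\lambda'$ with $0\le\lambda'\le p'-1$. Put $g_0=f(p'-1,p-1,\kappa,-1)$ and $g_1=g_0-\lambda d_3$. When $\kappa+\lambda<p$ one has $\lambda\le p-3$ and $\lambda'\ge1$, and $\tau=\lfloor \lambda/(p-\lambda)\rfloor$ is the unique integer with $0\le\tau<\lambda$ and $\frac{\tau+2}{\tau+1}<\frac{p}{\lambda}<\frac{\tau+1}{\tau}$ (the right-hand inequality being vacuous when $\tau=0$). Such a pair is of Type I if $\frac{\tau+2}{\tau+1}<\frac{p'}{\lambda'}$ and of Type II if $\frac{p'}{\lambda'}\le\frac{\tau+2}{\tau+1}$. -}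

module Defs where

open import Data.Nat as ℕ using (ℕ; suc; _∸_; _≤_; _<_)
open import Data.Nat.DivMod using (_/_)
open import Data.Integer as ℤ using (ℤ; +_; -[1+_])
open import Data.Product using (∃-syntax)
open import Relation.Binary.PropositionalEquality using (_≡_)

-- p' = (p-1)/2 (natural-number floor division; exact for odd p)
half↓ : ℕ → ℕ
half↓ n = (n ∸ 1) / 2

module _ (p q : ℕ) where
  d₀ d₁ d₂ d₃ : ℤ
  d₀ = + (p ℕ.* q)
  d₁ = + (half↓ p ℕ.* q)
  d₂ = + (p ℕ.* half↓ q)
  d₃ = + half↓ (p ℕ.* q)

  f : ℤ → ℤ → ℤ → ℤ → ℤ
  f x y z w = x ℤ.* d₀ ℤ.+ y ℤ.* d₁ ℤ.+ z ℤ.* d₂ ℤ.+ w ℤ.* d₃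

  Representable : ℤ → Set
  Representable n = ∃[ x ] ∃[ y ] ∃[ z ] ∃[ w ] (f (+ x) (+ y) (+ z) (+ w) ≡ n)

  g₀ : ℕ → ℤ
  g₀ κ = f (+ half↓ p ℤ.- + 1) (+ p ℤ.- + 1) (+ κ) -[1+ 0 ]

  g₁ : ℕ → ℕ → ℤ
  g₁ κ λ′ = g₀ κ ℤ.- (+ λ′) ℤ.* d₃

-- Type I: (τ+2)/(τ+1) < p'/λ'   (positive denominators; cross-multiplied)
TypeI : (τ p′ λ′ : ℕ) → Set
TypeI τ p′ λ′ = (τ ℕ.+ 2) ℕ.* λ′ < (τ ℕ.+ 1) ℕ.* p′

-- Write p = 2p′ + 1 and q = 2q′ + 1. Because κ + λ < p, the quotient of q′ by p′ is κ and
-- λ = 2λ′ + 1 − κ, so everything is a polynomial in p′, κ, λ′, τ (with d₃ = p′ + q′ + 2p′q′).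
--
-- For a pair of Type I the explicit nonnegative vector
--   x = (τ+1)p′ − (τ+2)λ′ − 1,  y = p − τ − 3,  z = (τ+3)κ + τ,  w = p − (τ+1)(p−λ) − 1
-- represents g₁; here w ≥ 0 because (τ+1)(p−λ) ≤ p, with equality excluded since p is prime
-- and 1 < p−λ < p.
--
-- Conversely, doubling f(x,y,z,w) = g₁ and using 2d₃ = pq − 1 gives s·pq = yq + zp + w + 2λ + 1
-- with s = 2x + y + z + w − (2p − 6 + κ − λ). If (p,q) is not of Type I, then with
-- (τ+2)(p−λ) > p the resulting system of integer inequalities has no solution; each case of the
-- argument is closed by a nonnegative combination of the hypotheses that is identically negative.
module Submission where

open import Defs
open import Data.Empty using (⊥)
open import Data.Product using (_×_; _,_)
open import Data.Sum using (_⊎_; inj₁; inj₂; [_,_]′)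
open import Function.Bundles using (_⇔_; mk⇔)
open import Relation.Binary.PropositionalEquality
open import Relation.Nullary using (contradiction)
open import Relation.Nullary.Decidable using (decidable-stable)

module Arithmetic where
  open import Data.Nat
  open import Data.Nat.Properties
  open import Data.Nat.DivMod using (_/_; _%_; m*n/n≡m; m≡m%n+[m/n]*n; m%n<n; [m+kn]%n≡m%n; m<n⇒m%n≡m)
  open import Data.Nat.Divisibility using (divides)
  open import Data.Nat.Primality using (Prime; prime⇒irreducible)
  open import Data.Nat.Tactic.RingSolver using (solve-∀)

  half↓-odd : ∀ k → half↓ (suc (2 * k)) ≡ k
  half↓-odd k = trans (cong (_/ 2) (*-comm 2 k)) (m*n/n≡m k 2)

  half↓-odd-product : ∀ a b → half↓ (suc (2 * a) * suc (2 * b)) ≡ a + b + 2 * a * b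
  half↓-odd-product a b = trans (cong half↓ (odd-product a b)) (half↓-odd _)
    where
    odd-product : ∀ a b → suc (2 * a) * suc (2 * b) ≡ suc (2 * (a + b + 2 * a * b))
    odd-product = solve-∀

  odd-prime : ∀ {n} → Prime n → 2 < n → n ≡ suc (2 * half↓ n)
  odd-prime {suc m} n-prime 2<n with m % 2 | m≡m%n+[m/n]*n m 2 | m%n<n m 2
  ... | 0 | m≡ | _ = cong suc (trans m≡ (*-comm (m / 2) 2))
  ... | 1 | m≡ | _ =
    contradiction (prime⇒irreducible n-prime (divides (suc (m / 2)) (cong suc m≡))) [ (λ ()) , <⇒≢ 2<n ]′
  ... | suc (suc _) | _ | s≤s (s≤s ())

  nontrivial-multiple≢prime : ∀ {p m} k → Prime p → 1 < m → m < p → k * m ≢ p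
  nontrivial-multiple≢prime k p-prime 1<m m<p k*m≡p
    with prime⇒irreducible p-prime (divides k (sym k*m≡p))
  ... | inj₁ m≡1 = <⇒≢ 1<m (sym m≡1)
  ... | inj₂ m≡p = <⇒≢ m<p m≡p

  quotients-agree : ∀ {a b κ l κ′ l′} →
    suc (2 * b) ≡ κ * suc (2 * a) + l → b ≡ κ′ * a + l′ → l′ ≤ a ∸ 1 → 1 ≤ l → κ + l < suc (2 * a) →
    κ′ ≡ κ × κ + l ≡ suc (2 * l′)
  quotients-agree {zero} {κ = κ} {suc l₀} _ _ _ _ κ+l<1 =
    contradiction (subst (_< 1) (+-suc κ l₀) κ+l<1) λ { (s≤s ()) }
  quotients-agree {a@(suc _)} {b} {κ} {suc l₀} {κ′} {l′} q≡ b≡ l′<a _ κ+l<p =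
    *-cancelʳ-≡ κ′ κ (2 * a) same-quotient , trans (+-suc κ l₀) (cong suc (sym same-remainder))
    where
    open ≡-Reasoning
    same-division : 2 * l′ + κ′ * (2 * a) ≡ (κ + l₀) + κ * (2 * a)
    same-division = suc-injective (begin
      suc (2 * l′ + κ′ * (2 * a))   ≡⟨ lhs κ′ a l′ ⟩
      suc (2 * (κ′ * a + l′))       ≡⟨ cong (λ n → suc (2 * n)) b≡ ⟨
      suc (2 * b)                   ≡⟨ q≡ ⟩
      κ * suc (2 * a) + suc l₀      ≡⟨ rhs κ a l₀ ⟩
      suc ((κ + l₀) + κ * (2 * a))  ∎)
      where
      lhs : ∀ κ′ a l′ → suc (2 * l′ + κ′ * (2 * a)) ≡ suc (2 * (κ′ * a + l′))
      lhs = solve-∀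
      rhs : ∀ κ a l₀ → κ * suc (2 * a) + suc l₀ ≡ suc ((κ + l₀) + κ * (2 * a))
      rhs = solve-∀
    same-remainder : 2 * l′ ≡ κ + l₀
    same-remainder = begin
      2 * l′                              ≡⟨ m<n⇒m%n≡m (*-monoʳ-< 2 (s≤s l′<a)) ⟨
      (2 * l′) % (2 * a)                  ≡⟨ [m+kn]%n≡m%n (2 * l′) κ′ (2 * a) ⟨
      (2 * l′ + κ′ * (2 * a)) % (2 * a)   ≡⟨ cong (_% (2 * a)) same-division ⟩
      ((κ + l₀) + κ * (2 * a)) % (2 * a)  ≡⟨ [m+kn]%n≡m%n (κ + l₀) κ (2 * a) ⟩
      (κ + l₀) % (2 * a)                  ≡⟨ m<n⇒m%n≡m (s≤s⁻¹ (subst (_< suc (2 * a)) (+-suc κ l₀) κ+l<p)) ⟩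
      κ + l₀                              ∎
    same-quotient : κ′ * (2 * a) ≡ κ * (2 * a)
    same-quotient = +-cancelˡ-≡ (2 * l′) _ _
      (trans same-division (cong (_+ κ * (2 * a)) (sym same-remainder)))

  1<p∸l : ∀ {p q κ l} → q ≡ κ * p + l → κ + l < p → p < q → 1 < p ∸ l
  1<p∸l {κ = zero}  refl l<p p<l = contradiction p<l (<-asym l<p)
  1<p∸l {p} {κ = suc κ} {l} _ κ+l<p _ =
    subst (_≤ p ∸ l) (m+n∸n≡m 2 l) (∸-monoˡ-≤ l (≤-trans (s≤s (s≤s (m≤n+m l κ))) κ+l<p))

  [1+τ]μ<p : ∀ {p l μ τ} → Prime p → 1 < μ → 1 ≤ l → μ + l ≡ p → τ * μ ≤ l → suc τ * μ < p
  [1+τ]μ<p {τ = τ} p-prime 1<μ 1≤l μ+l≡p τμ≤l =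
    ≤∧≢⇒< (subst (_ ≤_) μ+l≡p (+-monoʳ-≤ _ τμ≤l))
          (nontrivial-multiple≢prime (suc τ) p-prime 1<μ (subst (_ <_) μ+l≡p (m<m+n _ 1≤l)))

  p<[2+τ]μ : ∀ {p l μ τ} → μ + l ≡ p → l < suc τ * μ → p < suc (suc τ) * μ
  p<[2+τ]μ μ+l≡p l<[1+τ]μ = subst (_< _) μ+l≡p (+-monoʳ-< _ l<[1+τ]μ)

  3+τ≤p : ∀ {p μ} τ → 2 ≤ μ → 2 < p → suc τ * μ ≤ p → 3 + τ ≤ p
  3+τ≤p zero    _   2<p _        = 2<p
  3+τ≤p (suc τ) 2≤μ _   [1+τ]μ≤p =
    ≤-trans (+-monoʳ-≤ 4 (m≤m*n τ 2)) (≤-trans (*-monoʳ-≤ (2 + τ) 2≤μ) [1+τ]μ≤p)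

module Representations where
  open import Data.Nat as ℕ using (ℕ; z≤n)
  import Data.Nat.Properties as ℕ
  open import Data.Integer
  open import Data.Integer.Properties using (pos-*; i≤j⇒0≤j-i)
  open import Data.Integer.Tactic.RingSolver using (solve-∀)
  open Arithmetic using (half↓-odd-product)

  NonNeg : ℤ → Set
  NonNeg i = 0ℤ ≤ i

  nonNeg-pos : ∀ n → NonNeg (+ n)
  nonNeg-pos _ = +≤+ z≤n

  nonNeg-+ : ∀ {i j} → NonNeg i → NonNeg j → NonNeg (i + j)
  nonNeg-+ (+≤+ _) (+≤+ _) = +≤+ z≤n

  nonNeg-* : ∀ {i j} → NonNeg i → NonNeg j → NonNeg (i * j)
  nonNeg-* (+≤+ {n = m} _) (+≤+ {n = n} _) = subst NonNeg (pos-* m n) (nonNeg-pos _)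

  nonNeg-or-negative : ∀ i → NonNeg i ⊎ NonNeg (- i - 1ℤ)
  nonNeg-or-negative (+ _)    = inj₁ (nonNeg-pos _)
  nonNeg-or-negative -[1+ _ ] = inj₂ (nonNeg-pos _)

  nonNeg-difference : ∀ {m n i j} → m ℕ.≤ n → + m ≡ i → + n ≡ j → NonNeg (j - i)
  nonNeg-difference m≤n refl refl = i≤j⇒0≤j-i (+≤+ m≤n)

  refute : ∀ {i n} → i ≡ -[1+ n ] → NonNeg i → ⊥
  refute refl ()

  ≡-modulo : ∀ {u v i j} k → u ≡ v → i ≡ j + k * (u - v) → i ≡ j
  ≡-modulo {u} {j = j} k refl i≡ = trans i≡ (vanish j k u)
    where
    vanish : ∀ j k u → j + k * (u - u) ≡ j
    vanish = solve-∀

  factor-positive : ∀ {m u r} → NonNeg m → NonNeg r → m * u ≡ r + 1ℤ → NonNeg (u - 1ℤ)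
  factor-positive {m} {u} {r} m≥0 r≥0 m*u≡r+1 =
    [ (λ u≥1 → u≥1) , u≤0 ]′ (nonNeg-or-negative (u - 1ℤ))
    where
    u≤0 : NonNeg (- (u - 1ℤ) - 1ℤ) → NonNeg (u - 1ℤ)
    u≤0 -u≥0 = contradiction (nonNeg-+ (nonNeg-* m≥0 -u≥0) r≥0)
      (refute (≡-modulo (- 1ℤ) m*u≡r+1 (certificate m u r)))
      where
      certificate : ∀ m u r → m * (- (u - 1ℤ) - 1ℤ) + r ≡ - 1ℤ + - 1ℤ * (m * u - (r + 1ℤ))
      certificate = solve-∀

  infeasible : ∀ {P L D T j c} →
    NonNeg (P - 1ℤ) → NonNeg L → NonNeg (P - L) → NonNeg T → NonNeg (j + 1ℤ) →
    NonNeg ((j + 1ℤ) * D - c * (P - 1ℤ) - + 2) →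
    NonNeg (c * P - j * (P - L) - 1ℤ) →
    NonNeg (P - 1ℤ - (+ 2 + T) * D) →
    NonNeg ((+ 2 + T) * (P - L) - (1ℤ + P)) → ⊥
  infeasible {P} {L} {D} {T} {j} {c} P≥1 L≥0 L≤P T≥0 j≥-1 H₁ H₂ H₃ H₄ =
    [ (λ c≥0 → [ j-large c≥0 , j-small ]′ (nonNeg-or-negative (j - (+ 2 + T) * c))) , c-negative ]′
      (nonNeg-or-negative c)
    where
    c-negative : NonNeg (- c - 1ℤ) → ⊥
    c-negative c<0 = refute (certificate P L j c)
      (nonNeg-+ (nonNeg-+ (nonNeg-+ (nonNeg-+ H₂ (nonNeg-* P≥1 c<0)) c<0) (nonNeg-* L≤P j≥-1)) L≥0)
      where
      certificate : ∀ P L j c →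
        c * P - j * (P - L) - 1ℤ + (P - 1ℤ) * (- c - 1ℤ) + (- c - 1ℤ) + (P - L) * (j + 1ℤ) + L ≡ - 1ℤ
      certificate = solve-∀
    j-large : NonNeg c → NonNeg (j - (+ 2 + T) * c) → ⊥
    j-large c≥0 j≥[2+T]c = refute (certificate P L T j c)
      (nonNeg-+ (nonNeg-+ (nonNeg-+ H₂ (nonNeg-* L≤P j≥[2+T]c)) (nonNeg-* c≥0 H₄)) c≥0)
      where
      certificate : ∀ P L T j c →
        c * P - j * (P - L) - 1ℤ + (P - L) * (j - (+ 2 + T) * c)
          + c * ((+ 2 + T) * (P - L) - (1ℤ + P)) + c ≡ - 1ℤ
      certificate = solve-∀
    j-small : NonNeg (- (j - (+ 2 + T) * c) - 1ℤ) → ⊥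
    j-small j<[2+T]c = refute (certificate P D T j c)
      (nonNeg-+ (nonNeg-+ (nonNeg-+ (nonNeg-* P≥1 j<[2+T]c) (nonNeg-* (nonNeg-+ (nonNeg-pos 2) T≥0) H₁))
                          (nonNeg-* j≥-1 H₃))
                (nonNeg-+ T≥0 T≥0))
      where
      certificate : ∀ P D T j c →
        (P - 1ℤ) * (- (j - (+ 2 + T) * c) - 1ℤ) + (+ 2 + T) * ((j + 1ℤ) * D - c * (P - 1ℤ) - + 2)
          + (j + 1ℤ) * (P - 1ℤ - (+ 2 + T) * D) + (T + T) ≡ - + 4
      certificate = solve-∀

  -- The doubled equation forces s ≥ 1 and sP − Y ≥ 1; in the variables j and c the
  -- constraint W ≥ 0 is exactly the second inequality of infeasible, and X ≥ 0 implies the first.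
  infeasible-representation : ∀ {P K L T X Y Z W} →
    NonNeg (P - 1ℤ) → NonNeg K → NonNeg L → NonNeg (P - L) → NonNeg T →
    NonNeg X → NonNeg Y → NonNeg Z → NonNeg W →
    (+ 2 * X + Y + Z + W - (+ 2 * P - + 6 + K - L)) * P * (K * P + L)
      ≡ Y * (K * P + L) + Z * P + W + + 2 * L + 1ℤ →
    NonNeg (P - 1ℤ - (+ 2 + T) * (P - L - K)) →
    NonNeg ((+ 2 + T) * (P - L) - (1ℤ + P)) → ⊥
  infeasible-representation {P} {K} {L} {T} {X} {Y} {Z} {W}
                            P≥1 K≥0 L≥0 L≤P T≥0 X≥0 Y≥0 Z≥0 W≥0 equation H₃ H₄ =
    infeasible {P} {L} {P - L - K} {T} {j} {c} P≥1 L≥0 L≤P T≥0 j≥-1 H₁ H₂ H₃ H₄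
    where
    Q s j c R : ℤ
    Q = K * P + L
    s = + 2 * X + Y + Z + W - (+ 2 * P - + 6 + K - L)
    j = s * P - Y - + 2
    c = (s * P - Y) * (1ℤ + K) - + 2 - Z
    R = Z * P + W + + 2 * L
    P≥0 : NonNeg P
    P≥0 = subst NonNeg (identity P) (nonNeg-+ P≥1 (nonNeg-pos 1))
      where
      identity : ∀ P → P - 1ℤ + 1ℤ ≡ P
      identity = solve-∀
    Q≥0 : NonNeg Q
    Q≥0 = nonNeg-+ (nonNeg-* K≥0 P≥0) L≥0
    R≥0 : NonNeg R
    R≥0 = nonNeg-+ (nonNeg-+ (nonNeg-* Z≥0 P≥0) W≥0) (nonNeg-* (nonNeg-pos 2) L≥0)
    s≥1 : NonNeg (s - 1ℤ)
    s≥1 = factor-positive (nonNeg-* P≥0 Q≥0) (nonNeg-+ (nonNeg-* Y≥0 Q≥0) R≥0)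
            (≡-modulo 1ℤ equation (identity s P Q Y Z W L))
      where
      identity : ∀ s P Q Y Z W L →
        P * Q * s ≡ Y * Q + (Z * P + W + + 2 * L) + 1ℤ
                    + 1ℤ * (s * P * Q - (Y * Q + Z * P + W + + 2 * L + 1ℤ))
      identity = solve-∀
    j≥-1 : NonNeg (j + 1ℤ)
    j≥-1 = subst NonNeg (identity s P Y)
             (factor-positive Q≥0 R≥0 (≡-modulo 1ℤ equation (identity′ s P Q Y Z W L)))
      where
      identity : ∀ s P Y → s * P - Y - 1ℤ ≡ s * P - Y - + 2 + 1ℤ
      identity = solve-∀
      identity′ : ∀ s P Q Y Z W L →
        Q * (s * P - Y) ≡ Z * P + W + + 2 * L + 1ℤ
                          + 1ℤ * (s * P * Q - (Y * Q + Z * P + W + + 2 * L + 1ℤ))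
      identity′ = solve-∀
    H₁ : NonNeg ((j + 1ℤ) * (P - L - K) - c * (P - 1ℤ) - + 2)
    H₁ = subst NonNeg (sym (≡-modulo (- 1ℤ) equation (identity P K L X Y Z W)))
           (nonNeg-+ (nonNeg-* (nonNeg-pos 2) X≥0) (nonNeg-* s≥1 P≥1))
      where
      identity : ∀ P K L X Y Z W →
        let Q = K * P + L; s = + 2 * X + Y + Z + W - (+ 2 * P - + 6 + K - L) in
        (s * P - Y - + 2 + 1ℤ) * (P - L - K) - ((s * P - Y) * (1ℤ + K) - + 2 - Z) * (P - 1ℤ) - + 2
          ≡ + 2 * X + (s - 1ℤ) * (P - 1ℤ) + - 1ℤ * (s * P * Q - (Y * Q + Z * P + W + + 2 * L + 1ℤ))
      identity = solve-∀
    H₂ : NonNeg (c * P - j * (P - L) - 1ℤ)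
    H₂ = subst NonNeg (sym (≡-modulo 1ℤ equation (identity s P K L Y Z W))) W≥0
      where
      identity : ∀ s P K L Y Z W → let Q = K * P + L in
        ((s * P - Y) * (1ℤ + K) - + 2 - Z) * P - (s * P - Y - + 2) * (P - L) - 1ℤ
          ≡ W + 1ℤ * (s * P * Q - (Y * Q + Z * P + W + + 2 * L + 1ℤ))
      identity = solve-∀

  -- P, Q, A, B, L′, D₃ stand for p, q, p′, q′, λ′, d₃; the fields B≡ and L≡ say that κ′ = κ
  -- and λ = 2λ′ + 1 − κ.
  record Coordinates (P Q A B K L L′ D₃ : ℤ) : Set where
    constructor coordinates
    field
      P≡ : P ≡ 1ℤ + + 2 * A
      Q≡ : Q ≡ 1ℤ + + 2 * B
      B≡ : B ≡ K * A + L′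
      L≡ : L ≡ 1ℤ + + 2 * L′ - K
      D₃≡ : D₃ ≡ A + B + + 2 * A * B

  doubled-representation : ∀ {P Q A B K L L′ D₃ X Y Z W} → Coordinates P Q A B K L L′ D₃ →
    X * (P * Q) + Y * (A * Q) + Z * (P * B) + W * D₃
      ≡ (A - 1ℤ) * (P * Q) + (P - 1ℤ) * (A * Q) + K * (P * B) + - 1ℤ * D₃ - L * D₃ →
    (+ 2 * X + Y + Z + W - (+ 2 * P - + 6 + K - L)) * P * (K * P + L)
      ≡ Y * (K * P + L) + Z * P + W + + 2 * L + 1ℤ
  doubled-representation {A = A} {K = K} {L′ = L′} {X = X} {Y} {Z} {W}
                         (coordinates refl refl refl refl refl) eq =
    ≡-modulo (+ 2) eq (identity A K L′ X Y Z W)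
    where
    identity : ∀ A K L′ X Y Z W →
      let P = 1ℤ + + 2 * A; B = K * A + L′; Q = 1ℤ + + 2 * B; L = 1ℤ + + 2 * L′ - K; D₃ = A + B + + 2 * A * B in
      (+ 2 * X + Y + Z + W - (+ 2 * P - + 6 + K - L)) * P * (K * P + L)
        ≡ Y * (K * P + L) + Z * P + W + + 2 * L + 1ℤ
          + + 2 * ((X * (P * Q) + Y * (A * Q) + Z * (P * B) + W * D₃)
                   - ((A - 1ℤ) * (P * Q) + (P - 1ℤ) * (A * Q) + K * (P * B) + - 1ℤ * D₃ - L * D₃))
    identity = solve-∀

  not-typeI : ∀ {P Q A B K L L′ D₃ T} → Coordinates P Q A B K L L′ D₃ →
    NonNeg ((T + + 2) * L′ - (T + 1ℤ) * A) → NonNeg (P - 1ℤ - (+ 2 + T) * (P - L - K))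
  not-typeI {A = A} {K = K} {L′ = L′} {T = T} (coordinates refl refl refl refl refl) ¬I =
    subst NonNeg (identity A K L′ T) (nonNeg-* (nonNeg-pos 2) ¬I)
    where
    identity : ∀ A K L′ T → let P = 1ℤ + + 2 * A; L = 1ℤ + + 2 * L′ - K in
      + 2 * ((T + + 2) * L′ - (T + 1ℤ) * A) ≡ P - 1ℤ - (+ 2 + T) * (P - L - K)
    identity = solve-∀

  typeI-representation : ∀ {P Q A B K L L′ D₃} T → Coordinates P Q A B K L L′ D₃ →
    let X = (T + 1ℤ) * A - (1ℤ + (T + + 2) * L′)
        Y = P - (+ 3 + T)
        Z = (+ 3 + T) * K + T
        W = P - (1ℤ + (1ℤ + T) * (P - L)) in
    X * (P * Q) + Y * (A * Q) + Z * (P * B) + W * D₃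
      ≡ (A - 1ℤ) * (P * Q) + (P - 1ℤ) * (A * Q) + K * (P * B) + - 1ℤ * D₃ - L * D₃
  typeI-representation {A = A} {K = K} {L′ = L′} T (coordinates refl refl refl refl refl) =
    identity A K L′ T
    where
    identity : ∀ A K L′ T →
      let P = 1ℤ + + 2 * A; B = K * A + L′; Q = 1ℤ + + 2 * B; L = 1ℤ + + 2 * L′ - K; D₃ = A + B + + 2 * A * B
          X = (T + 1ℤ) * A - (1ℤ + (T + + 2) * L′)
          Y = P - (+ 3 + T)
          Z = (+ 3 + T) * K + T
          W = P - (1ℤ + (1ℤ + T) * (P - L)) in
      X * (P * Q) + Y * (A * Q) + Z * (P * B) + W * D₃
        ≡ (A - 1ℤ) * (P * Q) + (P - 1ℤ) * (A * Q) + K * (P * B) + - 1ℤ * D₃ - L * D₃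
    identity = solve-∀

  f≡ : ∀ p q X Y Z W →
    f p q X Y Z W ≡ X * (+ p * + q) + Y * (+ half↓ p * + q) + Z * (+ p * + half↓ q) + W * d₃ p q
  f≡ p q X Y Z W rewrite sym (pos-* p q) | sym (pos-* (half↓ p) q) | sym (pos-* p (half↓ q)) = refl

  representable : ∀ {p q n X Y Z W} → NonNeg X → NonNeg Y → NonNeg Z → NonNeg W →
    f p q X Y Z W ≡ n → Representable p q n
  representable (+≤+ {n = x} _) (+≤+ {n = y} _) (+≤+ {n = z} _) (+≤+ {n = w} _) eq =
    x , y , z , w , eq

  Coordinatesℕ : (p q κ l l′ : ℕ) → Set
  Coordinatesℕ p q κ l l′ = Coordinates (+ p) (+ q) (+ half↓ p) (+ half↓ q) (+ κ) (+ l) (+ l′) (d₃ p q)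

  coordinates-of : ∀ {p q κ l κ′ l′} →
    p ≡ ℕ.suc (2 ℕ.* half↓ p) → q ≡ ℕ.suc (2 ℕ.* half↓ q) → half↓ q ≡ κ′ ℕ.* half↓ p ℕ.+ l′ →
    κ′ ≡ κ × κ ℕ.+ l ≡ ℕ.suc (2 ℕ.* l′) →
    Coordinatesℕ p q κ l l′
  coordinates-of {p} {q} {κ} {l} {l′ = l′} p≡ q≡ b≡ (refl , κ+l≡) =
    coordinates (odd a p≡) (odd b q≡)
    (trans (cong +_ b≡) (cong (λ i → i + + l′) (pos-* κ a)))
    (≡-modulo 1ℤ (odd l′ κ+l≡) (identity (+ κ) (+ l) (+ l′)))
    (trans (cong +_ (trans (cong half↓ (cong₂ ℕ._*_ p≡ q≡)) (half↓-odd-product a b)))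
           (cong (λ i → + a + + b + i) (trans (pos-* (2 ℕ.* a) b) (cong (_* + b) (pos-* 2 a)))))
    where
    a b : ℕ
    a = half↓ p
    b = half↓ q
    odd : ∀ {n} k → n ≡ ℕ.suc (2 ℕ.* k) → + n ≡ 1ℤ + + 2 * + k
    odd k refl = cong (λ i → 1ℤ + i) (pos-* 2 k)
    identity : ∀ K L L′ → L ≡ 1ℤ + + 2 * L′ - K + 1ℤ * ((K + L) - (1ℤ + + 2 * L′))
    identity = solve-∀

  module _ {p q κ l l′ τ μ : ℕ}
           (coords : Coordinatesℕ p q κ l l′)
           (μ+l≡p : μ ℕ.+ l ≡ p) where

    private
      μ≡ : + μ ≡ + p - + l
      μ≡ = ≡-modulo 1ℤ (cong +_ μ+l≡p) (identity (+ μ) (+ l) (+ p))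
        where
        identity : ∀ M L P → M ≡ P - L + 1ℤ * ((M + L) - P)
        identity = solve-∀

      multiple : ∀ k → + (k ℕ.* μ) ≡ + k * (+ p - + l)
      multiple k = trans (pos-* k μ) (cong (+ k *_) μ≡)

      g₁≡ : g₁ p q κ l ≡ (+ half↓ p - 1ℤ) * (+ p * + q) + (+ p - 1ℤ) * (+ half↓ p * + q)
                         + + κ * (+ p * + half↓ q) + - 1ℤ * d₃ p q - + l * d₃ p q
      g₁≡ = cong (_- + l * d₃ p q) (f≡ p q (+ half↓ p - 1ℤ) (+ p - 1ℤ) (+ κ) (- 1ℤ))

    representable⇒typeI : 1 ℕ.≤ p → p ℕ.< ℕ.suc (ℕ.suc τ) ℕ.* μ →
      Representable p q (g₁ p q κ l) → TypeI τ (half↓ p) l′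
    representable⇒typeI 1≤p p<[2+τ]μ (x , y , z , w , eq) =
      decidable-stable (_ ℕ.<? _) λ ¬I →
        infeasible-representation {+ p} {+ κ} {+ l} {+ τ} {+ x} {+ y} {+ z} {+ w}
          (nonNeg-difference 1≤p refl refl) (nonNeg-pos κ) (nonNeg-pos l) (subst NonNeg μ≡ (nonNeg-pos μ))
          (nonNeg-pos τ) (nonNeg-pos x) (nonNeg-pos y) (nonNeg-pos z) (nonNeg-pos w)
          (doubled-representation {X = + x} {+ y} {+ z} {+ w} coords
            (trans (sym (f≡ p q (+ x) (+ y) (+ z) (+ w))) (trans eq g₁≡)))
          (not-typeI {T = + τ} coords
            (nonNeg-difference (ℕ.≮⇒≥ ¬I) (pos-* (τ ℕ.+ 1) (half↓ p)) (pos-* (τ ℕ.+ 2) l′)))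
          (nonNeg-difference p<[2+τ]μ refl (multiple (ℕ.suc (ℕ.suc τ))))

    typeI⇒representable : ℕ.suc τ ℕ.* μ ℕ.< p → 3 ℕ.+ τ ℕ.≤ p →
      TypeI τ (half↓ p) l′ → Representable p q (g₁ p q κ l)
    typeI⇒representable [1+τ]μ<p 3+τ≤p I =
      representable {p} {q} X≥0 Y≥0 Z≥0 W≥0
        (trans (f≡ p q X Y Z W) (trans (typeI-representation T coords) (sym g₁≡)))
      where
      T X Y Z W : ℤ
      T = + τ
      X = (T + 1ℤ) * + half↓ p - (1ℤ + (T + + 2) * + l′)
      Y = + p - (+ 3 + T)
      Z = (+ 3 + T) * + κ + T
      W = + p - (1ℤ + (1ℤ + T) * (+ p - + l))
      X≥0 : NonNeg X
      X≥0 = nonNeg-difference I (cong (λ i → 1ℤ + i) (pos-* (τ ℕ.+ 2) l′)) (pos-* (τ ℕ.+ 1) (half↓ p))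
      Y≥0 : NonNeg Y
      Y≥0 = nonNeg-difference 3+τ≤p refl refl
      Z≥0 : NonNeg Z
      Z≥0 = nonNeg-+ (nonNeg-* (nonNeg-pos (3 ℕ.+ τ)) (nonNeg-pos κ)) (nonNeg-pos τ)
      W≥0 : NonNeg W
      W≥0 = nonNeg-difference [1+τ]μ<p (cong (λ i → 1ℤ + i) (multiple (ℕ.suc τ))) refl

open import Data.Nat using (ℕ; suc; _+_; _*_; _∸_; _≤_; _<_; s≤s; z≤n)
open import Data.Nat.Properties using (m∸n+n≡m; ≤-trans; <-trans; <⇒≤; m≤n+m)
open import Data.Nat.Primality using (Prime)
open Arithmetic using (odd-prime; quotients-agree; 1<p∸l; [1+τ]μ<p; p<[2+τ]μ; 3+τ≤p)
open Representations using (Coordinatesℕ; coordinates-of; representable⇒typeI; typeI⇒representable)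

proposition7p3 : (p q : ℕ) → Prime p → Prime q → 2 < p → p < q →
    (κ l κ′ l′ τ : ℕ) →
    q ≡ κ * p + l → 1 ≤ l → l ≤ p ∸ 1 →
    half↓ q ≡ κ′ * half↓ p + l′ → l′ ≤ half↓ p ∸ 1 →
    κ + l < p →
    τ * (p ∸ l) ≤ l → l < suc τ * (p ∸ l) →
    Representable p q (g₁ p q κ l) ⇔ TypeI τ (half↓ p) l′
proposition7p3 p q p-prime q-prime 2<p p<q κ l κ′ l′ τ q≡κp+l 1≤l _ q′≡κ′p′+l′ l′≤p′∸1 κ+l<p τμ≤l l<[1+τ]μ =
  mk⇔ (representable⇒typeI {τ = τ} coords μ+l≡p (≤-trans (s≤s z≤n) 2<p) (p<[2+τ]μ {τ = τ} μ+l≡p l<[1+τ]μ))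
      (typeI⇒representable {τ = τ} coords μ+l≡p [1+τ]μ<p′ (3+τ≤p τ 1<μ 2<p (<⇒≤ [1+τ]μ<p′)))
  where
  -- The unused hypothesis l ≤ p ∸ 1 follows from κ + l < p.
  μ+l≡p : (p ∸ l) + l ≡ p
  μ+l≡p = m∸n+n≡m (≤-trans (m≤n+m l κ) (<⇒≤ κ+l<p))
  1<μ : 1 < p ∸ l
  1<μ = 1<p∸l {κ = κ} q≡κp+l κ+l<p p<q
  [1+τ]μ<p′ : suc τ * (p ∸ l) < p
  [1+τ]μ<p′ = [1+τ]μ<p {τ = τ} p-prime 1<μ 1≤l μ+l≡p τμ≤l
  p≡ : p ≡ suc (2 * half↓ p)
  p≡ = odd-prime p-prime 2<p
  q≡ : q ≡ suc (2 * half↓ q)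
  q≡ = odd-prime q-prime (<-trans 2<p p<q)
  coords : Coordinatesℕ p q κ l l′
  coords = coordinates-of p≡ q≡ q′≡κ′p′+l′
    (quotients-agree {half↓ p} {half↓ q} {κ} {l} {κ′}
      (trans (sym q≡) (trans q≡κp+l (cong (λ n → κ * n + l) p≡))) q′≡κ′p′+l′ l′≤p′∸1 1≤l
      (subst (κ + l <_) p≡ κ+l<p))
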